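{- The bilinear pairing $\langle\!\langle\cdot,\cdot\rangle\!\rangle:\Gamma_n\times\Theta_n\to R$ satisfies $\langle\!\langle \beta,\alpha\rangle\!\rangle=0$ for all $\alpha\in\Theta_n$ and all $\beta\in I_n$.
   Context: Let $R$ be a commutative ring with unit, $X=\{x_1<\dots<x_n\}$. A 2v-colored binary tree on $X$ is a planar binary tree whose leaves are bijectively labeled by $X$ and whose internal vertices (each with a left and a right child) are colored red or blue; $\Theta_n$ is the free $R$-module on these. An oriented two-colored graph on $X$ is a directed multigraph on vertex set $X$ (not necessarily connected) whose edges are colored red or blue; $\Gamma_n$ is the free $R$-module on these. For an oriented two-colored graph $H$ and a directed colored edge $e$ write $H+e$ for the graph with $e$ added. $I_n\subseteq\Gamma_n$ is the submodule generated by: (a) symmetry combinations $(H+(i\to j))+(H+(j\to i))$ with both added edges of the same color; (b) Jacobi combinations $\sum_{(a,b,c)}(H+(a\to b)+(b\to c))$, the sum over the cyclic rotations $(a,b,c)\in\{(i,j,k),(j,k,i),(k,i,j)\}$ of distinct vertices $i,j,k$, all added edges having one common color; (c) mixed Jacobi combinations $\sum_{(a,b,c)}\big[(H+(a\to b)_{\mathrm{blue}}+(b\to c)_{\mathrm{red}})+(H+(a\to b)_{\mathrm{red}}+(b\to c)_{\mathrm{blue}})\big]$ over the same cyclic rotations; (d) graphs having more than one edge between some pair of vertices; (e) disconnected graphs. For a tree $T$ and graph $G$, define $\beta_{G,T}$ from the edges of $G$ to internal vertices of $T$ by sending an edge $i\to j$ to the nadir of the path between leaves $i$ and $j$ in $T$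 (the vertex of the path closest to the root). Let $N$ be the number of edges $i\to j$ of $G$ for which leaf $i$ lies below the right child and leaf $j$ below the left child of this nadir, and $\tau_{G,T}=(-1)^N$. Set $\langle\!\langle G,T\rangle\!\rangle=\tau_{G,T}$ if $\beta_{G,T}$ is a bijection and each edge $e$ has the same color as $\beta_{G,T}(e)$, and $0$ otherwise; extend bilinearly. -}

module Defs where

open import Level using (Level)
open import Data.Bool using (Bool; true; false; _∧_; _∨_; not; if_then_else_)
open import Data.Nat using (ℕ; zero; suc)
open import Data.Fin using (Fin; _≟_)
open import Data.List using (List; []; _∷_; _++_; map; foldr; allFin; length; lookup)
open import Data.List.Relation.Binary.Permutation.Propositional using (_↭_)
open import Data.Maybe using (Maybe; just; nothing)
open import Data.Product using (_×_; _,_; Σ; proj₁; proj₂)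
open import Relation.Binary.PropositionalEquality using (_≡_; _≢_)
open import Relation.Nullary using (¬_; yes; no)
open import Algebra.Bundles using (CommutativeRing)
open import Data.Sum using (_⊎_)
open import Data.List.Membership.Propositional using (_∈_)

data Color : Set where
  red blue : Color

_==ᶜ_ : Color → Color → Bool
red  ==ᶜ red  = true
blue ==ᶜ blue = true
_    ==ᶜ _    = false

-- 2v-colored planar binary trees with leaves labelled by Fin n
data Tree (n : ℕ) : Set where
  leaf : Fin n → Tree n
  node : Color → Tree n → Tree n → Tree n

leaves : ∀ {n} → Tree n → List (Fin n)
leaves (leaf i)     = i ∷ []
leaves (node _ l r) = leaves l ++ leaves r

WellLabelled : ∀ {n} → Tree n → Set
WellLabelled {n} T = leaves T ↭ allFin n

-- basis elements of Θ_n
LTree : ℕ → Set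
LTree n = Σ (Tree n) WellLabelled

data Dir : Set where
  L R : Dir

Addr : Set
Addr = List Dir

_==ᵈ_ : Dir → Dir → Bool
L ==ᵈ L = true
R ==ᵈ R = true
_ ==ᵈ _ = false

_==ᵃ_ : Addr → Addr → Bool
[]      ==ᵃ []      = true
(d ∷ p) ==ᵃ (e ∷ q) = (d ==ᵈ e) ∧ (p ==ᵃ q)
_       ==ᵃ _       = false

internals : ∀ {n} → Tree n → List (Addr × Color)
internals (leaf _)     = []
internals (node c l r) =
  ([] , c) ∷ (map (λ { (a , k) → (L ∷ a , k) }) (internals l)
           ++ map (λ { (a , k) → (R ∷ a , k) }) (internals r))

-- address of (the first occurrence of) a leaf
orElse : {A : Set} → Maybe A → Maybe A → Maybe A
orElse (just x) _ = just x
orElse nothing  y = y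

mapMaybe′ : {A B : Set} → (A → B) → Maybe A → Maybe B
mapMaybe′ f (just x) = just (f x)
mapMaybe′ f nothing  = nothing

leafAddr : ∀ {n} → Tree n → Fin n → Maybe Addr
leafAddr (leaf j) i with i ≟ j
... | yes _ = just []
... | no  _ = nothing
leafAddr (node _ l r) i =
  orElse (mapMaybe′ (L ∷_) (leafAddr l i)) (mapMaybe′ (R ∷_) (leafAddr r i))

colorAt : ∀ {n} → Tree n → Addr → Maybe Color
colorAt (leaf _)     _       = nothing
colorAt (node c _ _) []      = just c
colorAt (node _ l _) (L ∷ p) = colorAt l p
colorAt (node _ _ r) (R ∷ p) = colorAt r p

-- nadir of the path between two leaves with addresses p, q:
-- the address of the branching vertex, together with the directions
-- taken there towards the first and towards the second leaf.
nadir : Addr → Addr → Maybe (Addr × Dir × Dir)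
nadir (L ∷ p) (L ∷ q) = mapMaybe′ (λ { (a , x) → (L ∷ a , x) }) (nadir p q)
nadir (R ∷ p) (R ∷ q) = mapMaybe′ (λ { (a , x) → (R ∷ a , x) }) (nadir p q)
nadir (L ∷ _) (R ∷ _) = just ([] , L , R)
nadir (R ∷ _) (L ∷ _) = just ([] , R , L)
nadir _       _       = nothing

-- Oriented two-coloured graphs on Fin n (multigraphs, as edge lists)
record Edge (n : ℕ) : Set where
  constructor _⟶_∶_
  field
    src : Fin n
    tgt : Fin n
    col : Color
open Edge public

Graph : ℕ → Set
Graph n = List (Edge n)

_+ₑ_ : ∀ {n} → Graph n → Edge n → Graph n
H +ₑ e = e ∷ H

-- β_{G,T}(e) as an internal vertex address, plus whether e contributes
-- to N (source below right child, target below left child of nadir),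
-- plus whether the colour of e agrees with the colour of β_{G,T}(e).
data EdgeImage : Set where
  img : Addr → Bool → Bool → EdgeImage

edgeImage : ∀ {n} → Tree n → Edge n → Maybe EdgeImage
edgeImage T e with leafAddr T (src e) | leafAddr T (tgt e)
... | just p | just q with nadir p q
...   | just (a , ds , dt) with colorAt T a
...     | just c = just (img a (ds ==ᵈ R ∧ dt ==ᵈ L) (c ==ᶜ col e))
...     | nothing = nothing
edgeImage T e | just p | just q | nothing = nothing
edgeImage T e | just _ | nothing = nothing
edgeImage T e | nothing | _ = nothing

images : ∀ {n} → Tree n → Graph n → Maybe (List EdgeImage)
images T []      = just []
images T (e ∷ G) with edgeImage T e | images T G
... | just x | just xs = just (x ∷ xs)
... | _      | _       = nothing

countAt : Addr → List EdgeImage → ℕ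
countAt a []                 = 0
countAt a (img b _ _ ∷ xs) = if a ==ᵃ b then suc (countAt a xs) else countAt a xs

isOne : ℕ → Bool
isOne (suc zero) = true
isOne _          = false

allB : {A : Set} → (A → Bool) → List A → Bool
allB p []       = true
allB p (x ∷ xs) = p x ∧ allB p xs

bijective : ∀ {n} → Tree n → List EdgeImage → Bool
bijective T xs = allB (λ { (a , _) → isOne (countAt a xs) }) (internals T)

coloursAgree : List EdgeImage → Bool
coloursAgree = allB (λ { (img _ _ ok) → ok })

parity : List EdgeImage → Bool
parity []                 = false
parity (img _ f _ ∷ xs) = if f then not (parity xs) else parity xs

module Pairing {c ℓ : Level} (Rg : CommutativeRing c ℓ) where
  open CommutativeRing Rg

  ⟪_,_⟫ : ∀ {n} → Graph n → Tree n → Carrier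
  ⟪ G , T ⟫ with images T G
  ... | nothing = 0#
  ... | just xs =
    if bijective T xs ∧ coloursAgree xs
    then (if parity xs then - 1# else 1#)
    else 0#

  -- elements of Γ_n and Θ_n as finite formal R-linear combinations
  Γ : ℕ → Set c
  Γ n = List (Carrier × Graph n)

  Θ : ℕ → Set c
  Θ n = List (Carrier × LTree n)

  sumR : List Carrier → Carrier
  sumR = foldr _+_ 0#

  ⟪⟪_,_⟫⟫ : ∀ {n} → Γ n → Θ n → Carrier
  ⟪⟪ β , α ⟫⟫ =
    sumR (map (λ { (r , G) →
      sumR (map (λ { (s , T) → (r * s) * ⟪ G , proj₁ T ⟫ }) α) }) β)

-- Generators of I_n

SamePair : ∀ {n} → Edge n → Edge n → Set
SamePair e f = (src e ≡ src f × tgt e ≡ tgt f) ⊎ (src e ≡ tgt f × tgt e ≡ src f)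

HasMultiEdge : ∀ {n} → Graph n → Set
HasMultiEdge G = Σ (Fin (length G)) λ p → Σ (Fin (length G)) λ q →
  (p ≢ q) × SamePair (lookup G p) (lookup G q)

data Reach {n : ℕ} (G : Graph n) : Fin n → Fin n → Set where
  here : ∀ {u} → Reach G u u
  fwd  : ∀ {u v} (e : Edge n) → e ∈ G →
         src e ≡ u → Reach G (tgt e) v → Reach G u v
  bwd  : ∀ {u v} (e : Edge n) → e ∈ G →
         tgt e ≡ u → Reach G (src e) v → Reach G u v

Connected : ∀ {n} → Graph n → Set
Connected {n} G = (u v : Fin n) → Reach G u v

Distinct3 : ∀ {n} → Fin n → Fin n → Fin n → Set
Distinct3 i j k = (i ≢ j) × (j ≢ k) × (k ≢ i)

data Gen (n : ℕ) : Set where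
  symm   : (H : Graph n) (i j : Fin n) → i ≢ j → (c : Color) → Gen n
  jacobi : (H : Graph n) (i j k : Fin n) → Distinct3 i j k → (c : Color) → Gen n
  mixed  : (H : Graph n) (i j k : Fin n) → Distinct3 i j k → Gen n
  multi  : (G : Graph n) → HasMultiEdge G → Gen n
  discon : (G : Graph n) → ¬ Connected G → Gen n

rotations : ∀ {n} → Fin n → Fin n → Fin n → List (Fin n × Fin n × Fin n)
rotations i j k = (i , j , k) ∷ (j , k , i) ∷ (k , i , j) ∷ []

concatMap′ : {A B : Set} → (A → List B) → List A → List B
concatMap′ f []       = []
concatMap′ f (x ∷ xs) = f x ++ concatMap′ f xs

genTerms : ∀ {n} → Gen n → List (Graph n)
genTerms (symm H i j _ c) = ((H +ₑ (i ⟶ j ∶ c))) ∷ ((H +ₑ (j ⟶ i ∶ c))) ∷ []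
genTerms (jacobi H i j k _ c) =
  map (λ { (a , b , d) → (H +ₑ (a ⟶ b ∶ c)) +ₑ (b ⟶ d ∶ c) }) (rotations i j k)
genTerms (mixed H i j k _) =
  concatMap′ (λ { (a , b , d) →
      ((H +ₑ (a ⟶ b ∶ blue)) +ₑ (b ⟶ d ∶ red))
    ∷ ((H +ₑ (a ⟶ b ∶ red)) +ₑ (b ⟶ d ∶ blue)) ∷ [] }) (rotations i j k)
genTerms (multi G _)  = G ∷ []
genTerms (discon G _) = G ∷ []

module Ideal {c ℓ : Level} (Rg : CommutativeRing c ℓ) where
  open CommutativeRing Rg
  open Pairing Rg

  genElem : ∀ {n} → Gen n → Γ n
  genElem g = map (λ G → (1# , G)) (genTerms g)

  -- the element Σ_k r_k g_k of I_n
  combination : ∀ {n} → List (Carrier × Gen n) → Γ n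
  combination []             = []
  combination ((r , g) ∷ xs) =
    map (λ { (s , G) → (r * s , G) }) (genElem g) ++ combination xs

-- The pairing ⟪ G , T ⟫ only sees, for each edge of G, the image of the edge at its nadir in T:
-- the vertex, the orientation sign and whether the colours agree.  Reversing an edge keeps its
-- nadir and flips the sign, which kills the symmetry relations.  Of three leaves i, j, k of a tree
-- one, say k, branches off first, so k → i and k → j have the same image.  In a Jacobi sum the
-- term containing j → k and k → i then sends two edges to one vertex, so β is not a bijection,
-- while the other two terms have the same edge images up to order and one sign flip, and
-- cancel; the mixed relations work the same way with the colours paired crosswise.  A multiple
-- edge also sends two edges to one vertex.  Finally, when β is a bijection, every internal
-- vertex is the nadir of an edge joining its two subtrees, so by induction on the tree G
-- connects all the leaves, and disconnected graphs pair to zero.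

module Submission where

open import Defs
open import Level using (Level)
open import Algebra.Bundles using (CommutativeRing)
open import Data.Bool using (Bool; true; false; _∧_; not; if_then_else_)
open import Data.Bool.Properties using (∧-assoc; ∧-comm)
open import Data.Empty using (⊥; ⊥-elim)
open import Data.Fin using (Fin; zero; suc; _≟_)
open import Data.List using (List; []; _∷_; _++_; map; length; lookup)
open import Data.List.Membership.Propositional using (_∈_)
open import Data.List.Membership.Propositional.Properties using (∈-map⁺; ∈-++⁺ˡ; ∈-++⁺ʳ; ∈-++⁻; ∈-allFin)
open import Data.List.Properties using (map-∘; ++-assoc)
open import Data.List.Relation.Binary.Pointwise using (Pointwise; []; _∷_)
open import Data.List.Relation.Binary.Permutation.Propositional using (↭-sym)
open import Data.List.Relation.Binary.Permutation.Propositional.Properties using (∈-resp-↭)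
open import Data.List.Relation.Unary.Any using (here; there)
open import Data.Maybe using (Maybe; just; nothing; zipWith)
open import Data.Maybe.Properties using (just-injective)
open import Data.Nat using (ℕ; zero; suc; _≤_; z≤n; s≤s)
open import Data.Nat.Properties using (≤-refl; ≤-reflexive; ≤-trans; n≤1+n)
open import Data.Product using (_×_; _,_; ∃; ∃₂; proj₁; proj₂)
import Data.Sum as Sum
open import Data.Sum using (_⊎_; inj₁; inj₂)
open import Function using (_∘_)
open import Relation.Binary.PropositionalEquality using (_≡_; _≢_; refl; sym; trans; cong; cong₂; subst; subst₂)
open import Relation.Nullary using (¬_; yes)

Branch : Set
Branch = Addr × Dir × Dir

under : Dir → Branch → Branch
under d (a , xy) = (d ∷ a , xy)

swapBranch : Branch → Branch
swapBranch (a , x , y) = (a , y , x)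

data Opposite : Dir → Dir → Set where
  L≠R : Opposite L R
  R≠L : Opposite R L

nadir-[]ʳ : ∀ p → nadir p [] ≡ nothing
nadir-[]ʳ []      = refl
nadir-[]ʳ (L ∷ _) = refl
nadir-[]ʳ (R ∷ _) = refl

under-swapBranch : ∀ d m →
  mapMaybe′ (under d) (mapMaybe′ swapBranch m) ≡ mapMaybe′ swapBranch (mapMaybe′ (under d) m)
under-swapBranch d nothing  = refl
under-swapBranch d (just _) = refl

nadir-comm : ∀ p q → nadir q p ≡ mapMaybe′ swapBranch (nadir p q)
nadir-comm []      q       = nadir-[]ʳ q
nadir-comm (L ∷ _) []      = refl
nadir-comm (R ∷ _) []      = refl
nadir-comm (L ∷ p) (L ∷ q) =
  trans (cong (mapMaybe′ (under L)) (nadir-comm p q)) (under-swapBranch L (nadir p q))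
nadir-comm (R ∷ p) (R ∷ q) =
  trans (cong (mapMaybe′ (under R)) (nadir-comm p q)) (under-swapBranch R (nadir p q))
nadir-comm (L ∷ _) (R ∷ _) = refl
nadir-comm (R ∷ _) (L ∷ _) = refl

nadir-split : ∀ p q {a x y} → nadir p q ≡ just (a , x , y) →
  Opposite x y × ∃₂ λ p′ q′ → p ≡ a ++ x ∷ p′ × q ≡ a ++ y ∷ q′
nadir-split (L ∷ p) (R ∷ q) refl = L≠R , p , q , refl , refl
nadir-split (R ∷ p) (L ∷ q) refl = R≠L , p , q , refl , refl
nadir-split (L ∷ p) (L ∷ q) eq with nadir p q in eq′
nadir-split (L ∷ p) (L ∷ q) refl | just _ with nadir-split p q eq′
... | opp , p′ , q′ , refl , refl = opp , p′ , q′ , refl , refl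
nadir-split (R ∷ p) (R ∷ q) eq with nadir p q in eq′
nadir-split (R ∷ p) (R ∷ q) refl | just _ with nadir-split p q eq′
... | opp , p′ , q′ , refl , refl = opp , p′ , q′ , refl , refl

Outlier : {A B : Set} → (A → A → B) → A → A → A → Set
Outlier d x y z = d z x ≡ d z y

HasOutlier : {A B : Set} → (A → A → B) → A → A → A → Set
HasOutlier d x y z = Outlier d x y z ⊎ Outlier d y z x ⊎ Outlier d z x y

hasOutlier-map : {A B C : Set} (d : A → A → B) (f : B → C) {x y z : A} →
  HasOutlier d x y z → HasOutlier (λ u v → f (d u v)) x y z
hasOutlier-map d f = Sum.map (cong f) (Sum.map (cong f) (cong f))

nadir-hasOutlier : ∀ p q r → HasOutlier nadir p q r
nadir-hasOutlier []      q       r       = inj₂ (inj₁ refl)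
nadir-hasOutlier (_ ∷ p) []      r       = inj₂ (inj₂ refl)
nadir-hasOutlier (_ ∷ p) (_ ∷ q) []      = inj₁ refl
nadir-hasOutlier (L ∷ p) (L ∷ q) (L ∷ r) =
  hasOutlier-map nadir (mapMaybe′ (under L)) {p} {q} {r} (nadir-hasOutlier p q r)
nadir-hasOutlier (R ∷ p) (R ∷ q) (R ∷ r) =
  hasOutlier-map nadir (mapMaybe′ (under R)) {p} {q} {r} (nadir-hasOutlier p q r)
nadir-hasOutlier (L ∷ p) (L ∷ q) (R ∷ r) = inj₁ refl
nadir-hasOutlier (R ∷ p) (R ∷ q) (L ∷ r) = inj₁ refl
nadir-hasOutlier (L ∷ p) (R ∷ q) (R ∷ r) = inj₂ (inj₁ refl)
nadir-hasOutlier (R ∷ p) (L ∷ q) (L ∷ r) = inj₂ (inj₁ refl)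
nadir-hasOutlier (L ∷ p) (R ∷ q) (L ∷ r) = inj₂ (inj₂ refl)
nadir-hasOutlier (R ∷ p) (L ∷ q) (R ∷ r) = inj₂ (inj₂ refl)

nadir? : Maybe Addr → Maybe Addr → Maybe Branch
nadir? (just p) (just q) = nadir p q
nadir? (just _) nothing  = nothing
nadir? nothing  _        = nothing

nadir?-hasOutlier : ∀ mp mq mr → HasOutlier nadir? mp mq mr
nadir?-hasOutlier nothing  mq       mr       = inj₂ (inj₁ refl)
nadir?-hasOutlier (just _) nothing  mr       = inj₂ (inj₂ refl)
nadir?-hasOutlier (just _) (just _) nothing  = inj₁ refl
nadir?-hasOutlier (just p) (just q) (just r) = nadir-hasOutlier p q r

leftward : Dir → Dir → Bool
leftward x y = x ==ᵈ R ∧ y ==ᵈ L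

imageAt : Addr → Bool → Maybe Color → Color → Maybe EdgeImage
imageAt a f (just k) c = just (img a f (k ==ᶜ c))
imageAt a f nothing  c = nothing

branchImage : ∀ {n} → Tree n → Maybe Branch → Color → Maybe EdgeImage
branchImage T nothing            c = nothing
branchImage T (just (a , x , y)) c = imageAt a (leftward x y) (colorAt T a) c

edgeImage-branch : ∀ {n} (T : Tree n) e →
  edgeImage T e ≡ branchImage T (nadir? (leafAddr T (src e)) (leafAddr T (tgt e))) (col e)
edgeImage-branch T e with leafAddr T (src e) | leafAddr T (tgt e)
... | just p | just q with nadir p q
...   | just (a , _ , _) with colorAt T a
...     | just _  = refl
...     | nothing = refl
edgeImage-branch T e | just p | just q | nothing = refl
edgeImage-branch T e | just _ | nothing = refl
edgeImage-branch T e | nothing | _ = refl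

address : EdgeImage → Addr
address (img a _ _) = a

flipSign : EdgeImage → EdgeImage
flipSign (img a f o) = img a (not f) o

branchImage-swap : ∀ {n} (T : Tree n) {a x y} → Opposite x y → ∀ c →
  branchImage T (just (a , y , x)) c ≡ mapMaybe′ flipSign (branchImage T (just (a , x , y)) c)
branchImage-swap T {a} opp c with colorAt T a
branchImage-swap T L≠R c | just _  = refl
branchImage-swap T R≠L c | just _  = refl
branchImage-swap T _   c | nothing = refl

branchImage-reverse : ∀ {n} (T : Tree n) mp mq c →
  branchImage T (nadir? mq mp) c ≡ mapMaybe′ flipSign (branchImage T (nadir? mp mq) c)
branchImage-reverse T nothing  nothing  c = refl
branchImage-reverse T nothing  (just _) c = refl
branchImage-reverse T (just _) nothing  c = refl
branchImage-reverse T (just p) (just q) c rewrite nadir-comm p q with nadir p q in eq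
... | nothing          = refl
... | just (a , x , y) = branchImage-swap T (proj₁ (nadir-split p q eq)) c

edgeImage-reverse : ∀ {n} (T : Tree n) i j c →
  edgeImage T (j ⟶ i ∶ c) ≡ mapMaybe′ flipSign (edgeImage T (i ⟶ j ∶ c))
edgeImage-reverse T i j c
  rewrite edgeImage-branch T (j ⟶ i ∶ c) | edgeImage-branch T (i ⟶ j ∶ c) =
  branchImage-reverse T (leafAddr T i) (leafAddr T j) c

site : Maybe EdgeImage → Maybe Addr
site = mapMaybe′ address

site-flipSign : ∀ m → site (mapMaybe′ flipSign m) ≡ site m
site-flipSign nothing          = refl
site-flipSign (just (img _ _ _)) = refl

branchImage-site : ∀ {n} (T : Tree n) m c c′ → site (branchImage T m c) ≡ site (branchImage T m c′)
branchImage-site T nothing            c c′ = refl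
branchImage-site T (just (a , _ , _)) c c′ with colorAt T a
... | just _  = refl
... | nothing = refl

edgeImage-site : ∀ {n} (T : Tree n) i j c c′ →
  site (edgeImage T (i ⟶ j ∶ c)) ≡ site (edgeImage T (i ⟶ j ∶ c′))
edgeImage-site T i j c c′
  rewrite edgeImage-branch T (i ⟶ j ∶ c) | edgeImage-branch T (i ⟶ j ∶ c′) =
  branchImage-site T (nadir? (leafAddr T i) (leafAddr T j)) c c′

samePair-site : ∀ {n} (T : Tree n) e f → SamePair e f → site (edgeImage T e) ≡ site (edgeImage T f)
samePair-site T (i ⟶ j ∶ c) (_ ⟶ _ ∶ c′) (inj₁ (refl , refl)) = edgeImage-site T i j c c′
samePair-site T (i ⟶ j ∶ c) (_ ⟶ _ ∶ c′) (inj₂ (refl , refl)) =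
  trans (edgeImage-site T i j c c′)
        (sym (trans (cong site (edgeImage-reverse T i j c′)) (site-flipSign (edgeImage T (i ⟶ j ∶ c′)))))

colorAt-internal : ∀ {n} (T : Tree n) a {c} → colorAt T a ≡ just c → (a , c) ∈ internals T
colorAt-internal (node c l r) []      refl = here refl
colorAt-internal (node c l r) (L ∷ a) eq   = there (∈-++⁺ˡ (∈-map⁺ _ (colorAt-internal l a eq)))
colorAt-internal (node c l r) (R ∷ a) eq   = there (∈-++⁺ʳ _ (∈-map⁺ _ (colorAt-internal r a eq)))

edgeImage-internal : ∀ {n} (T : Tree n) e {x} → edgeImage T e ≡ just x → ∃ λ c → (address x , c) ∈ internals T
edgeImage-internal T e eq rewrite edgeImage-branch T e =
  internal (nadir? (leafAddr T (src e)) (leafAddr T (tgt e))) eq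
  where
  internal : ∀ m {x} → branchImage T m (col e) ≡ just x → ∃ λ c → (address x , c) ∈ internals T
  internal (just (a , _ , _)) eq with colorAt T a in ca
  internal (just (a , _ , _)) refl | just c = c , colorAt-internal T a ca

edgeImage-split : ∀ {n} (T : Tree n) e {x} → edgeImage T e ≡ just x →
  ∃₂ λ d d′ → Opposite d d′ × ∃₂ λ p q →
    leafAddr T (src e) ≡ just (address x ++ d ∷ p) × leafAddr T (tgt e) ≡ just (address x ++ d′ ∷ q)
edgeImage-split T e eq rewrite edgeImage-branch T e = split (leafAddr T (src e)) (leafAddr T (tgt e)) eq
  where
  split : ∀ mp mq {x} → branchImage T (nadir? mp mq) (col e) ≡ just x →
    ∃₂ λ d d′ → Opposite d d′ × ∃₂ λ p q →
      mp ≡ just (address x ++ d ∷ p) × mq ≡ just (address x ++ d′ ∷ q)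
  split (just p) (just q) eq with nadir p q in eqn
  ... | just (a , d , d′) with colorAt T a | eq
  ...   | just _ | refl with nadir-split p q eqn
  ...     | opp , p′ , q′ , refl , refl = d , d′ , opp , p′ , q′ , refl , refl

infixr 5 _∷?_
_∷?_ : ∀ {A : Set} → Maybe A → Maybe (List A) → Maybe (List A)
_∷?_ = zipWith _∷_

images-cons : ∀ {n} (T : Tree n) e G → images T (e ∷ G) ≡ edgeImage T e ∷? images T G
images-cons T e G with edgeImage T e | images T G
... | just _  | just _  = refl
... | just _  | nothing = refl
... | nothing | _       = refl

ImageList : ∀ {n} → Tree n → Graph n → List EdgeImage → Set
ImageList T = Pointwise (λ e x → edgeImage T e ≡ just x)

images-imageList : ∀ {n} (T : Tree n) G {xs} → images T G ≡ just xs → ImageList T G xs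
images-imageList T []      refl = []
images-imageList T (e ∷ G) eq with edgeImage T e in ex | images T G in eG | trans (sym (images-cons T e G)) eq
... | just _ | just _ | refl = ex ∷ images-imageList T G eG

imageList-lookup : ∀ {n} (T : Tree n) {G xs} → ImageList T G xs →
  (p : Fin (length G)) → ∃ λ x → edgeImage T (lookup G p) ≡ just x
imageList-lookup T (ex ∷ _)  zero    = _ , ex
imageList-lookup T (_  ∷ im) (suc p) = imageList-lookup T im p

==ᵃ-refl : ∀ a → (a ==ᵃ a) ≡ true
==ᵃ-refl []      = refl
==ᵃ-refl (L ∷ a) = ==ᵃ-refl a
==ᵃ-refl (R ∷ a) = ==ᵃ-refl a

==ᵃ-sound : ∀ {a b} → (a ==ᵃ b) ≡ true → a ≡ b
==ᵃ-sound {[]}    {[]}    _ = refl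
==ᵃ-sound {L ∷ a} {L ∷ b} h = cong (L ∷_) (==ᵃ-sound h)
==ᵃ-sound {R ∷ a} {R ∷ b} h = cong (R ∷_) (==ᵃ-sound h)

countAt-here : ∀ {a} x xs → address x ≡ a → countAt a (x ∷ xs) ≡ suc (countAt a xs)
countAt-here (img a _ _) xs refl rewrite ==ᵃ-refl a = refl

countAt-there : ∀ a x xs → countAt a xs ≤ countAt a (x ∷ xs)
countAt-there a (img b _ _) xs with a ==ᵃ b
... | true  = n≤1+n _
... | false = ≤-refl

countAt-≥1 : ∀ {n} (T : Tree n) {G xs} → ImageList T G xs → ∀ p {x a} →
  edgeImage T (lookup G p) ≡ just x → address x ≡ a → 1 ≤ countAt a xs
countAt-≥1 T {xs = x ∷ xs} (ex ∷ _) zero ex′ ax with just-injective (trans (sym ex) ex′)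
... | refl rewrite countAt-here x xs ax = s≤s z≤n
countAt-≥1 T {xs = x ∷ xs} (_ ∷ im) (suc p) ex ax = ≤-trans (countAt-≥1 T im p ex ax) (countAt-there _ x xs)

countAt-≥2 : ∀ {n} (T : Tree n) {G xs} → ImageList T G xs → ∀ p q → p ≢ q → ∀ {x y a} →
  edgeImage T (lookup G p) ≡ just x → edgeImage T (lookup G q) ≡ just y →
  address x ≡ a → address y ≡ a → 2 ≤ countAt a xs
countAt-≥2 T (_ ∷ _) zero zero p≢q _ _ _ _ = ⊥-elim (p≢q refl)
countAt-≥2 T {xs = x ∷ xs} (ex ∷ im) zero (suc q) _ ex′ ey ax ay with just-injective (trans (sym ex) ex′)
... | refl rewrite countAt-here x xs ax = s≤s (countAt-≥1 T im q ey ay)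
countAt-≥2 T {xs = y ∷ xs} (ey ∷ im) (suc p) zero _ ex ey′ ax ay with just-injective (trans (sym ey) ey′)
... | refl rewrite countAt-here y xs ay = s≤s (countAt-≥1 T im p ex ax)
countAt-≥2 T {xs = z ∷ xs} (_ ∷ im) (suc p) (suc q) p≢q ex ey ax ay =
  ≤-trans (countAt-≥2 T im p q (p≢q ∘ cong suc) ex ey ax ay) (countAt-there _ z xs)

Bijective : ∀ {n} → Tree n → Graph n → Set
Bijective T G = ∃ λ xs → images T G ≡ just xs × bijective T xs ≡ true

allB-∈ : ∀ {A : Set} (P : A → Bool) {xs x} → allB P xs ≡ true → x ∈ xs → P x ≡ true
allB-∈ P {y ∷ ys} h (here refl) with P y | h
... | true | _ = refl
allB-∈ P {y ∷ ys} h (there x∈ys) with P y | h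
... | true | h′ = allB-∈ P h′ x∈ys

isOne-sound : ∀ k → isOne k ≡ true → k ≡ 1
isOne-sound (suc zero) _ = refl

bijective-countAt : ∀ {n} (T : Tree n) {xs a c} →
  bijective T xs ≡ true → (a , c) ∈ internals T → countAt a xs ≡ 1
bijective-countAt T {xs} bij a∈T = isOne-sound _ (allB-∈ (λ { (a , _) → isOne (countAt a xs) }) bij a∈T)

allB-cong : ∀ {A : Set} {P Q : A → Bool} → (∀ x → P x ≡ Q x) → ∀ xs → allB P xs ≡ allB Q xs
allB-cong P≡Q []       = refl
allB-cong P≡Q (x ∷ xs) = cong₂ _∧_ (P≡Q x) (allB-cong P≡Q xs)

countAt-swap : ∀ a x y ys → countAt a (x ∷ y ∷ ys) ≡ countAt a (y ∷ x ∷ ys)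
countAt-swap a (img b _ _) (img b′ _ _) ys with a ==ᵃ b | a ==ᵃ b′
... | true  | true  = refl
... | true  | false = refl
... | false | true  = refl
... | false | false = refl

bijective-swap : ∀ {n} (T : Tree n) x y ys → bijective T (x ∷ y ∷ ys) ≡ bijective T (y ∷ x ∷ ys)
bijective-swap T x y ys = allB-cong (λ { (a , _) → cong isOne (countAt-swap a x y ys) }) (internals T)

coloursAgree-swap : ∀ x y ys → coloursAgree (x ∷ y ∷ ys) ≡ coloursAgree (y ∷ x ∷ ys)
coloursAgree-swap (img _ _ o) (img _ _ o′) ys =
  trans (sym (∧-assoc o o′ _)) (trans (cong (_∧ _) (∧-comm o o′)) (∧-assoc o′ o _))

parity-swap : ∀ x y ys → parity (x ∷ y ∷ ys) ≡ parity (y ∷ x ∷ ys)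
parity-swap (img _ false _) (img _ _ _)     ys = refl
parity-swap (img _ true _)  (img _ false _) ys = refl
parity-swap (img _ true _)  (img _ true _)  ys = refl

multiEdge-nonbijective : ∀ {n} (T : Tree n) G → HasMultiEdge G → ¬ Bijective T G
multiEdge-nonbijective T G (p , q , p≢q , same) (xs , eq , bij) = counted-twice (images-imageList T G eq)
  where
  same-address : ∀ {x y} → edgeImage T (lookup G p) ≡ just x → edgeImage T (lookup G q) ≡ just y →
    address x ≡ address y
  same-address ex ey = just-injective (subst₂ (λ m m′ → site m ≡ site m′) ex ey (samePair-site T _ _ same))
  counted-twice : ImageList T G xs → ⊥
  counted-twice im with imageList-lookup T im p | imageList-lookup T im q
  ... | x , ex | y , ey with edgeImage-internal T (lookup G p) ex
  ... | _ , x∈T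
    with subst (2 ≤_) (bijective-countAt T {xs} bij x∈T)
               (countAt-≥2 T im p q p≢q ex ey refl (sym (same-address ex ey)))
  ... | s≤s ()

Reach-trans : ∀ {n} {G : Graph n} {u v w} → Reach G u v → Reach G v w → Reach G u w
Reach-trans here                     h = h
Reach-trans (fwd e e∈G refl u⇝v) h = fwd e e∈G refl (Reach-trans u⇝v h)
Reach-trans (bwd e e∈G refl u⇝v) h = bwd e e∈G refl (Reach-trans u⇝v h)

Reach-sym : ∀ {n} {G : Graph n} {u v} → Reach G u v → Reach G v u
Reach-sym here                     = here
Reach-sym (fwd e e∈G refl u⇝v) = Reach-trans (Reach-sym u⇝v) (bwd e e∈G refl here)
Reach-sym (bwd e e∈G refl u⇝v) = Reach-trans (Reach-sym u⇝v) (fwd e e∈G refl here)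

subtreeAt : ∀ {n} → Tree n → Addr → Maybe (Tree n)
subtreeAt T            []      = just T
subtreeAt (leaf _)     (_ ∷ _) = nothing
subtreeAt (node _ l _) (L ∷ p) = subtreeAt l p
subtreeAt (node _ _ r) (R ∷ p) = subtreeAt r p

subtreeAt-++ : ∀ {n} (T : Tree n) a p {S} → subtreeAt T a ≡ just S → subtreeAt T (a ++ p) ≡ subtreeAt S p
subtreeAt-++ T            []      p refl = refl
subtreeAt-++ (node _ l _) (L ∷ a) p eq   = subtreeAt-++ l a p eq
subtreeAt-++ (node _ _ r) (R ∷ a) p eq   = subtreeAt-++ r a p eq

subtreeAt-colorAt : ∀ {n} (T : Tree n) a {c l r} → subtreeAt T a ≡ just (node c l r) → colorAt T a ≡ just c
subtreeAt-colorAt T            []      refl = refl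
subtreeAt-colorAt (node _ l _) (L ∷ a) eq   = subtreeAt-colorAt l a eq
subtreeAt-colorAt (node _ _ r) (R ∷ a) eq   = subtreeAt-colorAt r a eq

subtreeAt-leaf : ∀ {n} {w u : Fin n} p → subtreeAt (leaf w) p ≡ just (leaf u) → u ≡ w
subtreeAt-leaf [] refl = refl

leafAddr-subtreeAt : ∀ {n} (T : Tree n) {u p} → leafAddr T u ≡ just p → subtreeAt T p ≡ just (leaf u)
leafAddr-subtreeAt (leaf j) {u} eq with u ≟ j
leafAddr-subtreeAt (leaf j) refl | yes refl = refl
leafAddr-subtreeAt (node _ l r) {u} eq with leafAddr l u in eqˡ
leafAddr-subtreeAt (node _ l r) refl | just _ = leafAddr-subtreeAt l eqˡ
... | nothing with leafAddr r u in eqʳ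
leafAddr-subtreeAt (node _ l r) refl | nothing | just _ = leafAddr-subtreeAt r eqʳ

leafAddr-below : ∀ {n} (T : Tree n) a {S} → subtreeAt T a ≡ just S →
  ∀ {w} p → leafAddr T w ≡ just (a ++ p) → subtreeAt S p ≡ just (leaf w)
leafAddr-below T a sa p lw = trans (sym (subtreeAt-++ T a p sa)) (leafAddr-subtreeAt T lw)

∈leaves-subtreeAt : ∀ {n} (T : Tree n) {u} → u ∈ leaves T → ∃ λ p → subtreeAt T p ≡ just (leaf u)
∈leaves-subtreeAt (leaf _) (here refl) = [] , refl
∈leaves-subtreeAt (node _ l r) u∈T with ∈-++⁻ (leaves l) u∈T
... | inj₁ u∈l = let p , eq = ∈leaves-subtreeAt l u∈l in L ∷ p , eq
... | inj₂ u∈r = let p , eq = ∈leaves-subtreeAt r u∈r in R ∷ p , eq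

countAt-source : ∀ {n} (T : Tree n) {G xs a} → ImageList T G xs → 1 ≤ countAt a xs →
  ∃ λ e → e ∈ G × ∃ λ x → edgeImage T e ≡ just x × address x ≡ a
countAt-source T {xs = img b _ _ ∷ xs} {a} (ex ∷ im) pos with a ==ᵃ b in eq
... | true  = _ , here refl , _ , ex , sym (==ᵃ-sound eq)
... | false = let e , e∈G , rest = countAt-source T im pos in e , there e∈G , rest

module Connectivity {n} (T : Tree n) (G : Graph n) {xs}
                    (im : ImageList T G xs) (bij : bijective T xs ≡ true) where

  LeavesConnected : Tree n → Set
  LeavesConnected S =
    ∀ {u v} p q → subtreeAt S p ≡ just (leaf u) → subtreeAt S q ≡ just (leaf v) → Reach G u v

  edgeAt : ∀ a {c l r} → subtreeAt T a ≡ just (node c l r) →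
    ∃ λ e → e ∈ G × ∃ λ x → edgeImage T e ≡ just x × address x ≡ a
  edgeAt a sa = countAt-source T im (≤-reflexive (sym (bijective-countAt T {xs} bij a∈T)))
    where a∈T = colorAt-internal T a (subtreeAt-colorAt T a sa)

  connected-across : ∀ a {c l r} → subtreeAt T a ≡ just (node c l r) →
    LeavesConnected l → LeavesConnected r →
    ∀ {u v} p q → subtreeAt l p ≡ just (leaf u) → subtreeAt r q ≡ just (leaf v) → Reach G u v
  connected-across a sa conn-l conn-r p q hp hq with edgeAt a sa
  ... | e , e∈G , x , ex , refl with edgeImage-split T e ex
  ... | L , R , L≠R , p′ , q′ , ls , lt =
    Reach-trans (conn-l p p′ hp (leafAddr-below T a sa (L ∷ p′) ls))
                (fwd e e∈G refl (conn-r q′ q (leafAddr-below T a sa (R ∷ q′) lt) hq))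
  ... | R , L , R≠L , p′ , q′ , ls , lt =
    Reach-trans (conn-l p q′ hp (leafAddr-below T a sa (L ∷ q′) lt))
                (bwd e e∈G refl (conn-r p′ q (leafAddr-below T a sa (R ∷ p′) ls) hq))

  subtree-connected : ∀ S a → subtreeAt T a ≡ just S → LeavesConnected S
  subtree-connected (leaf w) a sa p q hp hq rewrite subtreeAt-leaf p hp | subtreeAt-leaf q hq = here
  subtree-connected (node c l r) a sa = node-connected
    where
    conn-l : LeavesConnected l
    conn-l = subtree-connected l (a ++ L ∷ []) (subtreeAt-++ T a (L ∷ []) sa)
    conn-r : LeavesConnected r
    conn-r = subtree-connected r (a ++ R ∷ []) (subtreeAt-++ T a (R ∷ []) sa)
    node-connected : LeavesConnected (node c l r)
    node-connected (L ∷ p) (L ∷ q)       = conn-l p q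
    node-connected (R ∷ p) (R ∷ q)       = conn-r p q
    node-connected (L ∷ p) (R ∷ q)       = connected-across a sa conn-l conn-r p q
    node-connected (R ∷ p) (L ∷ q) hp hq = Reach-sym (connected-across a sa conn-l conn-r q p hq hp)

bijective-connected : ∀ {n} (T : Tree n) G → WellLabelled T → Bijective T G → Connected G
bijective-connected T G wl (xs , eq , bij) u v =
  let p , hp = ∈leaves-subtreeAt T (∈-resp-↭ (↭-sym wl) (∈-allFin u))
      q , hq = ∈leaves-subtreeAt T (∈-resp-↭ (↭-sym wl) (∈-allFin v))
  in Connectivity.subtree-connected T G (images-imageList T G eq) bij T [] refl p q hp hq

leafNadir : ∀ {n} → Tree n → Fin n → Fin n → Maybe Branch
leafNadir T x y = nadir? (leafAddr T x) (leafAddr T y)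

outlier-edgeImage : ∀ {n} (T : Tree n) {i j k} → Outlier (leafNadir T) i j k →
  ∀ c → edgeImage T (k ⟶ i ∶ c) ≡ edgeImage T (k ⟶ j ∶ c)
outlier-edgeImage T o c =
  trans (edgeImage-branch T _) (trans (cong (λ m → branchImage T m c) o) (sym (edgeImage-branch T _)))

addPath : ∀ {n} → Graph n → Color → Color → Fin n → Fin n → Fin n → Graph n
addPath H c₁ c₂ a b d = (b ⟶ d ∶ c₂) ∷ (a ⟶ b ∶ c₁) ∷ H

rotationGraphs : ∀ {n} → (Fin n → Fin n → Fin n → List (Graph n)) → Fin n → Fin n → Fin n → List (Graph n)
rotationGraphs f i j k = f i j k ++ f j k i ++ f k i j

-- genTerms (jacobi H i j k _ c) and genTerms (mixed H i j k _) are, definitionally,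
-- rotationGraphs (jacobiPaths H c) i j k and rotationGraphs (mixedPaths H) i j k.
jacobiPaths : ∀ {n} → Graph n → Color → Fin n → Fin n → Fin n → List (Graph n)
jacobiPaths H c a b d = addPath H c c a b d ∷ []

mixedPaths : ∀ {n} → Graph n → Fin n → Fin n → Fin n → List (Graph n)
mixedPaths H a b d = addPath H blue red a b d ∷ addPath H red blue a b d ∷ []

module PairingProperties {c ℓ : Level} (Rg : CommutativeRing c ℓ) where

  open CommutativeRing Rg hiding (zero) renaming (refl to ≈-refl; sym to ≈-sym; trans to ≈-trans)
  open Pairing Rg
  open Ideal Rg
  open import Relation.Binary.Reasoning.Setoid setoid
  open import Algebra.Solver.CommutativeMonoid +-commutativeMonoid using (solve; _⊜_; _⊕_; id)

  sign : Bool → Carrier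
  sign b = if b then - 1# else 1#

  value : ∀ {n} → Tree n → Maybe (List EdgeImage) → Carrier
  value T nothing   = 0#
  value T (just xs) = if bijective T xs ∧ coloursAgree xs then sign (parity xs) else 0#

  pairing-value : ∀ {n} (G : Graph n) T → ⟪ G , T ⟫ ≡ value T (images T G)
  pairing-value G T with images T G
  ... | nothing = refl
  ... | just _  = refl

  pairing-cons : ∀ {n} (T : Tree n) e G → ⟪ e ∷ G , T ⟫ ≡ value T (edgeImage T e ∷? images T G)
  pairing-cons T e G = trans (pairing-value (e ∷ G) T) (cong (value T) (images-cons T e G))

  pairing-cons₂ : ∀ {n} (T : Tree n) e f G →
    ⟪ e ∷ f ∷ G , T ⟫ ≡ value T (edgeImage T e ∷? edgeImage T f ∷? images T G)
  pairing-cons₂ T e f G =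
    trans (pairing-cons T e (f ∷ G)) (cong (λ m → value T (edgeImage T e ∷? m)) (images-cons T f G))

  pairing-nonbijective : ∀ {n} (T : Tree n) G → ¬ Bijective T G → ⟪ G , T ⟫ ≡ 0#
  pairing-nonbijective T G nb = trans (pairing-value G T) (vanish (images T G) refl)
    where
    vanish : ∀ m → images T G ≡ m → value T m ≡ 0#
    vanish nothing   _  = refl
    vanish (just xs) eq with bijective T xs in bij
    ... | false = refl
    ... | true  = ⊥-elim (nb (xs , eq , bij))

  value-swap : ∀ {n} (T : Tree n) mx my mys →
    value T (mx ∷? my ∷? mys) ≡ value T (my ∷? mx ∷? mys)
  value-swap T nothing  nothing  mys       = refl
  value-swap T nothing  (just _) mys       = refl
  value-swap T (just _) nothing  mys       = refl
  value-swap T (just _) (just _) nothing   = refl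
  value-swap T (just x) (just y) (just ys) =
    cong₂ (λ B P → if B then sign P else 0#)
          (cong₂ _∧_ (bijective-swap T x y ys) (coloursAgree-swap x y ys)) (parity-swap x y ys)

  signs-cancel : ∀ B b → (if B then sign b else 0#) + (if B then sign (not b) else 0#) ≈ 0#
  signs-cancel true  true  = -‿inverseˡ 1#
  signs-cancel true  false = -‿inverseʳ 1#
  signs-cancel false _     = +-identityˡ 0#

  value-flip : ∀ {n} (T : Tree n) mx mys →
    value T (mx ∷? mys) + value T (mapMaybe′ flipSign mx ∷? mys) ≈ 0#
  value-flip T nothing  mys     = +-identityˡ 0#
  value-flip T (just _) nothing = +-identityˡ 0#
  value-flip T (just (img a false o)) (just ys) =
    signs-cancel (bijective T (img a false o ∷ ys) ∧ coloursAgree (img a false o ∷ ys)) (parity ys)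
  value-flip T (just (img a true o)) (just ys) =
    ≈-trans (+-comm _ _) (value-flip T (just (img a false o)) (just ys))

  sumR-++ : ∀ {a} {A : Set a} (f : A → Carrier) xs ys →
    sumR (map f (xs ++ ys)) ≈ sumR (map f xs) + sumR (map f ys)
  sumR-++ f []       ys = ≈-sym (+-identityˡ _)
  sumR-++ f (x ∷ xs) ys = ≈-trans (+-congˡ (sumR-++ f xs ys)) (≈-sym (+-assoc _ _ _))

  sumR-cong : ∀ {a} {A : Set a} {f g : A → Carrier} → (∀ x → f x ≈ g x) →
    ∀ xs → sumR (map f xs) ≈ sumR (map g xs)
  sumR-cong f≈g []       = ≈-refl
  sumR-cong f≈g (x ∷ xs) = +-cong (f≈g x) (sumR-cong f≈g xs)

  sumR-zero : ∀ {a} {A : Set a} {f : A → Carrier} → (∀ x → f x ≈ 0#) → ∀ xs → sumR (map f xs) ≈ 0#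
  sumR-zero f≈0 []       = ≈-refl
  sumR-zero f≈0 (x ∷ xs) = ≈-trans (+-cong (f≈0 x) (sumR-zero f≈0 xs)) (+-identityˡ 0#)

  sumR-+ : ∀ {a} {A : Set a} (f g : A → Carrier) xs →
    sumR (map f xs) + sumR (map g xs) ≈ sumR (map (λ x → f x + g x) xs)
  sumR-+ f g []       = +-identityˡ 0#
  sumR-+ f g (x ∷ xs) = ≈-trans (+-comm-middle (f x) _ (g x) _) (+-congˡ (sumR-+ f g xs))
    where
    +-comm-middle : ∀ a b c d → (a + b) + (c + d) ≈ (a + c) + (b + d)
    +-comm-middle a b c d = solve 4 (λ a b c d → (a ⊕ b) ⊕ (c ⊕ d) ⊜ (a ⊕ c) ⊕ (b ⊕ d)) ≈-refl a b c d

  sumR-*ˡ : ∀ {a} {A : Set a} (w : Carrier) (f : A → Carrier) xs →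
    sumR (map (λ x → w * f x) xs) ≈ w * sumR (map f xs)
  sumR-*ˡ w f []       = ≈-sym (zeroʳ w)
  sumR-*ˡ w f (x ∷ xs) = ≈-trans (+-congˡ (sumR-*ˡ w f xs)) (≈-sym (distribˡ w _ _))

  sumR-exchange : ∀ {a b} {A : Set a} {B : Set b} (h : A → B → Carrier) xs ys →
    sumR (map (λ x → sumR (map (h x) ys)) xs) ≈ sumR (map (λ y → sumR (map (λ x → h x y) xs)) ys)
  sumR-exchange h []       ys = ≈-sym (sumR-zero (λ _ → ≈-refl) ys)
  sumR-exchange h (x ∷ xs) ys = ≈-trans (+-congˡ (sumR-exchange h xs ys)) (sumR-+ (h x) _ ys)

  pairSum : ∀ {n} → Tree n → List (Graph n) → Carrier
  pairSum T = sumR ∘ map (λ G → ⟪ G , T ⟫)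

  symmetry-vanishes : ∀ {n} (T : Tree n) H i j c → ⟪ (i ⟶ j ∶ c) ∷ H , T ⟫ + ⟪ (j ⟶ i ∶ c) ∷ H , T ⟫ ≈ 0#
  symmetry-vanishes T H i j c = begin
    ⟪ (i ⟶ j ∶ c) ∷ H , T ⟫ + ⟪ (j ⟶ i ∶ c) ∷ H , T ⟫
      ≡⟨ cong₂ _+_ (pairing-cons T _ H) (pairing-cons T _ H) ⟩
    value T (e ∷? images T H) + value T (edgeImage T (j ⟶ i ∶ c) ∷? images T H)
      ≡⟨ cong (λ m → value T (e ∷? images T H) + value T (m ∷? images T H)) (edgeImage-reverse T i j c) ⟩
    value T (e ∷? images T H) + value T (mapMaybe′ flipSign e ∷? images T H)
      ≈⟨ value-flip T e (images T H) ⟩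
    0# ∎
    where e = edgeImage T (i ⟶ j ∶ c)

  module _ {n} (T : Tree n) (H : Graph n) {i j k : Fin n} (o : Outlier (leafNadir T) i j k) where

    private
      ε : Fin n → Fin n → Color → Maybe EdgeImage
      ε x y c = edgeImage T (x ⟶ y ∶ c)

    outlier-path-vanishes : ∀ c₁ c₂ → ⟪ addPath H c₁ c₂ j k i , T ⟫ ≈ 0#
    outlier-path-vanishes c₁ c₂ = begin
      ⟪ (k ⟶ i ∶ c₂) ∷ (j ⟶ k ∶ c₁) ∷ H , T ⟫
        ≡⟨ pairing-cons₂ T _ _ H ⟩
      value T (ε k i c₂ ∷? ε j k c₁ ∷? images T H)
        ≡⟨ cong (λ m → value T (m ∷? _)) (outlier-edgeImage T o c₂) ⟩
      value T (ε k j c₂ ∷? ε j k c₁ ∷? images T H)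
        ≡⟨ sym (pairing-cons₂ T _ _ H) ⟩
      ⟪ G , T ⟫
        ≡⟨ pairing-nonbijective T G (multiEdge-nonbijective T G double) ⟩
      0# ∎
      where
      G = (k ⟶ j ∶ c₂) ∷ (j ⟶ k ∶ c₁) ∷ H
      double : HasMultiEdge G
      double = zero , suc zero , (λ ()) , inj₂ (refl , refl)

    outlier-paths-cancel : ∀ c₁ c₂ → ⟪ addPath H c₁ c₂ i j k , T ⟫ + ⟪ addPath H c₂ c₁ k i j , T ⟫ ≈ 0#
    outlier-paths-cancel c₁ c₂ = begin
      ⟪ addPath H c₁ c₂ i j k , T ⟫ + ⟪ addPath H c₂ c₁ k i j , T ⟫
        ≡⟨ cong₂ _+_ (pairing-cons₂ T _ _ H) (pairing-cons₂ T _ _ H) ⟩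
      value T (e ∷? f ∷? Y) + value T (f ∷? ε k i c₂ ∷? Y)
        ≡⟨ cong (λ m → value T (e ∷? f ∷? Y) + value T (f ∷? m ∷? Y))
                (trans (outlier-edgeImage T o c₂) (edgeImage-reverse T j k c₂)) ⟩
      value T (e ∷? f ∷? Y) + value T (f ∷? mapMaybe′ flipSign e ∷? Y)
        ≡⟨ cong (value T (e ∷? f ∷? Y) +_) (value-swap T f _ Y) ⟩
      value T (e ∷? f ∷? Y) + value T (mapMaybe′ flipSign e ∷? f ∷? Y)
        ≈⟨ value-flip T e (f ∷? Y) ⟩
      0# ∎
      where
      Y = images T H
      e = ε j k c₂
      f = ε i j c₁

    jacobi-outlier : ∀ c → pairSum T (rotationGraphs (jacobiPaths H c) i j k) ≈ 0#
    jacobi-outlier c = begin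
      x₁ + (x₂ + (x₃ + 0#))
        ≈⟨ solve 3 (λ x₁ x₂ x₃ → x₁ ⊕ (x₂ ⊕ (x₃ ⊕ id)) ⊜ (x₁ ⊕ x₃) ⊕ x₂) ≈-refl x₁ x₂ x₃ ⟩
      (x₁ + x₃) + x₂
        ≈⟨ +-cong (outlier-paths-cancel c c) (outlier-path-vanishes c c) ⟩
      0# + 0#
        ≈⟨ +-identityˡ 0# ⟩
      0# ∎
      where
      x₁ = ⟪ addPath H c c i j k , T ⟫
      x₂ = ⟪ addPath H c c j k i , T ⟫
      x₃ = ⟪ addPath H c c k i j , T ⟫

    mixed-outlier : pairSum T (rotationGraphs (mixedPaths H) i j k) ≈ 0#
    mixed-outlier = begin
      x₁ + (x₂ + (x₃ + (x₄ + (x₅ + (x₆ + 0#)))))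
        ≈⟨ solve 6 (λ x₁ x₂ x₃ x₄ x₅ x₆ →
                      x₁ ⊕ (x₂ ⊕ (x₃ ⊕ (x₄ ⊕ (x₅ ⊕ (x₆ ⊕ id))))) ⊜ ((x₁ ⊕ x₆) ⊕ (x₂ ⊕ x₅)) ⊕ (x₃ ⊕ x₄))
                   ≈-refl x₁ x₂ x₃ x₄ x₅ x₆ ⟩
      ((x₁ + x₆) + (x₂ + x₅)) + (x₃ + x₄)
        ≈⟨ +-cong (+-cong (outlier-paths-cancel blue red) (outlier-paths-cancel red blue))
                  (+-cong (outlier-path-vanishes blue red) (outlier-path-vanishes red blue)) ⟩
      (0# + 0#) + (0# + 0#)
        ≈⟨ +-cong (+-identityˡ 0#) (+-identityˡ 0#) ⟩
      0# + 0#
        ≈⟨ +-identityˡ 0# ⟩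
      0# ∎
      where
      x₁ = ⟪ addPath H blue red i j k , T ⟫
      x₂ = ⟪ addPath H red blue i j k , T ⟫
      x₃ = ⟪ addPath H blue red j k i , T ⟫
      x₄ = ⟪ addPath H red blue j k i , T ⟫
      x₅ = ⟪ addPath H blue red k i j , T ⟫
      x₆ = ⟪ addPath H red blue k i j , T ⟫

  pairSum-++-comm : ∀ {n} (T : Tree n) Gs Gs′ → pairSum T (Gs ++ Gs′) ≈ pairSum T (Gs′ ++ Gs)
  pairSum-++-comm T Gs Gs′ = begin
    pairSum T (Gs ++ Gs′)                ≈⟨ sumR-++ _ Gs Gs′ ⟩
    pairSum T Gs + pairSum T Gs′         ≈⟨ +-comm _ _ ⟩
    pairSum T Gs′ + pairSum T Gs         ≈⟨ ≈-sym (sumR-++ _ Gs′ Gs) ⟩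
    pairSum T (Gs′ ++ Gs)                ∎

  pairSum-rotate : ∀ {n} (T : Tree n) f i j k →
    pairSum T (rotationGraphs f i j k) ≈ pairSum T (rotationGraphs f j k i)
  pairSum-rotate T f i j k = begin
    pairSum T (f i j k ++ f j k i ++ f k i j)    ≈⟨ pairSum-++-comm T (f i j k) _ ⟩
    pairSum T ((f j k i ++ f k i j) ++ f i j k)  ≡⟨ cong (pairSum T) (++-assoc (f j k i) _ _) ⟩
    pairSum T (f j k i ++ f k i j ++ f i j k)    ∎

  rotations-vanish : ∀ {n} (T : Tree n) f →
    (∀ {i j k} → Outlier (leafNadir T) i j k → pairSum T (rotationGraphs f i j k) ≈ 0#) →
    ∀ i j k → pairSum T (rotationGraphs f i j k) ≈ 0#
  rotations-vanish T f vanish i j k with nadir?-hasOutlier (leafAddr T i) (leafAddr T j) (leafAddr T k)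
  ... | inj₁ o        = vanish o
  ... | inj₂ (inj₁ o) = ≈-trans (pairSum-rotate T f i j k) (vanish o)
  ... | inj₂ (inj₂ o) = ≈-trans (pairSum-rotate T f i j k) (≈-trans (pairSum-rotate T f j k i) (vanish o))

  generator-vanishes : ∀ {n} (T : Tree n) → WellLabelled T → ∀ g → pairSum T (genTerms g) ≈ 0#
  generator-vanishes T wl (symm H i j _ c)     =
    ≈-trans (+-congˡ (+-identityʳ _)) (symmetry-vanishes T H i j c)
  generator-vanishes T wl (jacobi H i j k _ c) =
    rotations-vanish T (jacobiPaths H c) (λ o → jacobi-outlier T H o c) i j k
  generator-vanishes T wl (mixed H i j k _)    =
    rotations-vanish T (mixedPaths H) (mixed-outlier T H) i j k
  generator-vanishes T wl (multi G m)          =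
    ≈-trans (+-identityʳ _) (reflexive (pairing-nonbijective T G (multiEdge-nonbijective T G m)))
  generator-vanishes T wl (discon G nc)        =
    ≈-trans (+-identityʳ _) (reflexive (pairing-nonbijective T G (nc ∘ bijective-connected T G wl)))

  scaled-generator-vanishes : ∀ {n} r (g : Gen n) (α : Θ n) →
    ⟪⟪ map (λ { (s , G) → (r * s , G) }) (genElem g) , α ⟫⟫ ≈ 0#
  scaled-generator-vanishes r g α = begin
    ⟪⟪ map (λ { (s , G) → (r * s , G) }) (genElem g) , α ⟫⟫
      ≡⟨ cong sumR (sym (trans (map-∘ (genTerms g)) (map-∘ (map (1# ,_) (genTerms g))))) ⟩
    sumR (map (λ G → sumR (map (λ sT → weight sT * ⟪ G , proj₁ (proj₂ sT) ⟫) α)) (genTerms g))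
      ≈⟨ sumR-exchange (λ G sT → weight sT * ⟪ G , proj₁ (proj₂ sT) ⟫) (genTerms g) α ⟩
    sumR (map (λ sT → sumR (map (λ G → weight sT * ⟪ G , proj₁ (proj₂ sT) ⟫) (genTerms g))) α)
      ≈⟨ sumR-cong (λ sT → sumR-*ˡ (weight sT) _ (genTerms g)) α ⟩
    sumR (map (λ sT → weight sT * pairSum (proj₁ (proj₂ sT)) (genTerms g)) α)
      ≈⟨ sumR-zero (λ { (s , T , wl) → ≈-trans (*-congˡ (generator-vanishes T wl g)) (zeroʳ _) }) α ⟩
    0# ∎
    where
    weight : Carrier × LTree _ → Carrier
    weight (s , _) = (r * 1#) * s

  combination-vanishes : ∀ {n} (β : List (Carrier × Gen n)) (α : Θ n) → ⟪⟪ combination β , α ⟫⟫ ≈ 0#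
  combination-vanishes []            α = ≈-refl
  combination-vanishes ((r , g) ∷ β) α = begin
    ⟪⟪ combination ((r , g) ∷ β) , α ⟫⟫
      ≈⟨ sumR-++ _ (map _ (genElem g)) (combination β) ⟩
    ⟪⟪ map (λ { (s , G) → (r * s , G) }) (genElem g) , α ⟫⟫ + ⟪⟪ combination β , α ⟫⟫
      ≈⟨ +-cong (scaled-generator-vanishes r g α) (combination-vanishes β α) ⟩
    0# + 0#
      ≈⟨ +-identityˡ 0# ⟩
    0# ∎

proposition5p11 : ∀ {c ℓ : Level} (Rg : CommutativeRing c ℓ) (n : ℕ)
    (β : List (CommutativeRing.Carrier Rg × Gen n))
    (α : Pairing.Θ Rg n) →
    CommutativeRing._≈_ Rg
      (Pairing.⟪⟪_,_⟫⟫ Rg (Ideal.combination Rg β) α)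
      (CommutativeRing.0# Rg)
proposition5p11 Rg n = PairingProperties.combination-vanishes Rg
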